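{- Let $\Gamma$ be an infinite Abelian group which is not a torsion group, and let $T$ be a tree of diameter $5$ whose two central vertices $v_{c_1}$ and $v_{c_2}$ are both not support vertices. Then $T$ is $\Gamma$-vertex magic if and only if $\deg(v_{c_1})\neq 2$ and $\deg(v_{c_2})\neq 2$.
   Context: Graphs are finite, simple and undirected. For an additive Abelian group $\Gamma$ with identity $0$ and a graph $G$, a $\Gamma$-vertex magic labeling is a map $\ell:V(G)\to\Gamma\setminus\{0\}$ for which there is $\mu\in\Gamma$ with $w(v)=\sum_{u\in N(v)}\ell(u)=\mu$ for every vertex $v$; $G$ is $\Gamma$-vertex magic if it has such a labeling. A pendant vertex has degree $1$; a support vertex is a vertex adjacent to a pendant vertex. A tree of diameter $5$ has two (adjacent) central vertices $v_{c_1},v_{c_2}$, the two middle vertices of any longest path. A torsion group is one all of whose elements have finite order. -}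

module Defs where

open import Level using (Level; _⊔_)
open import Data.Nat using (ℕ; zero; suc; _+_; _≤_)
open import Data.Fin using (Fin; zero; suc)
open import Data.Bool using (Bool; true; false; if_then_else_)
open import Data.Product using (Σ; ∃; ∃-syntax; _×_; _,_)
open import Relation.Binary.PropositionalEquality using (_≡_)
open import Relation.Nullary using (¬_)
open import Algebra.Bundles using (AbelianGroup)

record Graph (n : ℕ) : Set where
  field
    adj     : Fin n → Fin n → Bool
    symm    : ∀ u v → adj u v ≡ adj v u
    irrefl  : ∀ v → adj v v ≡ false
open Graph public

module _ {n : ℕ} (G : Graph n) where

  Adj : Fin n → Fin n → Set
  Adj u v = adj G u v ≡ true

  data Walk : Fin n → Fin n → ℕ → Set where
    here : ∀ {v} → Walk v v 0
    step : ∀ {u w v k} → Adj u w → Walk w v k → Walk u v (suc k)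

  Connected : Set
  Connected = ∀ u v → ∃[ k ] Walk u v k

  Dist : Fin n → Fin n → ℕ → Set
  Dist u v k = Walk u v k × (∀ j → Walk u v j → k ≤ j)

  -- a cycle: a closed walk x0 - x1 - ... - x(m+2) - x0 through m+3 ≥ 3
  -- pairwise distinct vertices
  record Cycle : Set where
    field
      m        : ℕ
      vtx      : Fin (suc (suc (suc m))) → Fin n
      distinct : ∀ i j → vtx i ≡ vtx j → i ≡ j
      linked   : ∀ (i : Fin (suc (suc m))) →
                   Adj (vtx (Data.Fin.inject₁ i)) (vtx (suc i))
      closing  : Adj (vtx (Data.Fin.fromℕ (suc (suc m)))) (vtx zero)

  Acyclic : Set
  Acyclic = ¬ Cycle

  IsTree : Set
  IsTree = Connected × Acyclic

  HasDiameter : ℕ → Set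
  HasDiameter d = (∃[ u ] ∃[ v ] Dist u v d) × (∀ u v k → Dist u v k → k ≤ d)

foldFin : ∀ {a} {A : Set a} → (A → A → A) → A → {n : ℕ} → (Fin n → A) → A
foldFin _∙_ e {zero}  f = e
foldFin _∙_ e {suc n} f = f zero ∙ foldFin _∙_ e (λ i → f (suc i))

module _ {n : ℕ} (G : Graph n) where

  deg : Fin n → ℕ
  deg v = foldFin _+_ 0 (λ u → if adj G v u then 1 else 0)

  IsPendant : Fin n → Set
  IsPendant v = deg v ≡ 1

  IsSupport : Fin n → Set
  IsSupport v = ∃[ u ] (Adj G v u × IsPendant u)

  -- c1, c2 are the two middle vertices of a longest path x0 x1 c1 c2 x4 x5
  -- in a graph of diameter 5
  CentralPair : Fin n → Fin n → Set
  CentralPair c1 c2 =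
    ∃[ x0 ] ∃[ x1 ] ∃[ x4 ] ∃[ x5 ]
      (Adj G x0 x1 × Adj G x1 c1 × Adj G c1 c2 × Adj G c2 x4 × Adj G x4 x5
        × Dist G x0 x5 5)

module _ {c ℓ : Level} (Γ : AbelianGroup c ℓ) where
  open AbelianGroup Γ

  _·_ : ℕ → Carrier → Carrier
  zero  · x = ε
  suc k · x = x ∙ (k · x)

  IsFiniteGroup : Set (c ⊔ ℓ)
  IsFiniteGroup = ∃[ m ] Σ (Fin m → Carrier) (λ f → ∀ x → ∃[ i ] f i ≈ x)

  IsInfiniteGroup : Set (c ⊔ ℓ)
  IsInfiniteGroup = ¬ IsFiniteGroup

  HasInfiniteOrder : Carrier → Set ℓ
  HasInfiniteOrder x = ∀ k → ¬ (suc k · x ≈ ε)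

  IsNotTorsion : Set (c ⊔ ℓ)
  IsNotTorsion = ∃[ x ] HasInfiniteOrder x

  module _ {n : ℕ} (G : Graph n) where

    weight : (Fin n → Carrier) → Fin n → Carrier
    weight lab v = foldFin _∙_ ε (λ u → if adj G v u then lab u else ε)

    IsVertexMagicLabeling : (Fin n → Carrier) → Set (c ⊔ ℓ)
    IsVertexMagicLabeling lab =
      (∀ v → ¬ (lab v ≈ ε)) × ∃[ μ ] (∀ v → weight lab v ≈ μ)

    IsVertexMagic : Set (c ⊔ ℓ)
    IsVertexMagic = ∃[ lab ] IsVertexMagicLabeling lab

{-# OPTIONS --safe #-}
-- Since T has diameter 5, every neighbour a ≠ c₂ of c₁ has only pendant vertices besides c₁,
-- and it has at least one because c₁ is not a support vertex (symmetrically at c₂). In a magic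
-- labelling a pendant vertex at a has weight ℓ(a), so ℓ(a) = μ for all such a, and then
-- w(c₁) = ℓ(c₂) + (deg c₁ − 1)μ = μ forces ℓ(c₂) = 0 if deg c₁ = 2.
-- Conversely, for g of infinite order put μ = M·g with M a common multiple of the numbers
-- deg a − 1. Label c₁ by −(deg c₂ − 2)μ, c₂ by −(deg c₁ − 2)μ, their other neighbours by μ,
-- and share (deg c₂ − 1)μ equally among the deg a − 1 pendant vertices at a neighbour a of c₁
-- (symmetrically at c₂). All weights are μ, and all labels are nonzero multiples of g because
-- deg c₁ and deg c₂ are at least 3.

module Submission where

open import Defs hiding (_·_)
open import Level using (Level)
open import Algebra.Bundles using (AbelianGroup; CommutativeMonoid)
open import Data.Bool using (true; false; if_then_else_; _∨_)
open import Data.Bool.Properties as Bool using (¬-not; ∨-zeroʳ)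
open import Data.Empty using (⊥; ⊥-elim)
open import Data.Fin using (Fin; zero; suc; toℕ; fromℕ; inject₁; inject≤)
open import Data.Fin.Properties using (_≟_; any?; toℕ<n; inject≤-injective; suc-injective)
open import Data.Nat using (ℕ; zero; suc; _+_; _*_; _∸_; _≤_; _<_; z≤n; s≤s; NonZero)
open import Data.Nat.Properties
  using (+-0-commutativeMonoid; *-1-commutativeMonoid; ≤-trans; n≤1+n; m≤n⇒m≤1+n; ≤-pred; 1+n≰n; ≮⇒≥; ≤∧≢⇒<;
         anyUpTo?; *-comm; *-assoc; m*n≢0)
open import Data.Nat.Divisibility using (_∣_; divides; quotient; quotient≢0)
open import Data.Nat.Induction using (<-rec)
open import Data.Product using (Σ; ∃; _×_; _,_; proj₁; proj₂)
open import Data.Sum using (_⊎_; inj₁; inj₂; [_,_])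
open import Data.Unit using (⊤; tt)
open import Function using (_∘_)
open import Function.Bundles using (_⇔_; mk⇔)
open import Function.Definitions using (Injective)
open import Relation.Binary.PropositionalEquality using (_≡_; _≢_; refl; sym; trans; cong; subst; ≢-sym)
open import Relation.Nullary using (¬_; ¬?; Dec; yes; no; does)
open import Relation.Nullary.Decidable using (dec-true; dec-false; map′; _×-dec_)
open import Relation.Unary using (Pred; Decidable)

least : ∀ {p} {P : Pred ℕ p} → Decidable P → ∀ {k} → P k →
        ∃ λ j → P j × (∀ i → P i → j ≤ i)
least {P = P} P? {k} = <-rec (λ k → P k → ∃ λ j → P j × (∀ i → P i → j ≤ i)) below k
  where
  below : ∀ k → (∀ {j} → j < k → P j → ∃ λ j → P j × (∀ i → P i → j ≤ i)) → P k →
          ∃ λ j → P j × (∀ i → P i → j ≤ i)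
  below k smaller pk with anyUpTo? P? k
  ... | yes (j , j<k , pj) = smaller j<k pj
  ... | no none            = k , pk , λ i pi → ≮⇒≥ (λ i<k → none (i , i<k , pi))

module FoldFin {c ℓ} (M : CommutativeMonoid c ℓ) where
  open CommutativeMonoid M using (Carrier; _≈_; _∙_; ε; ∙-cong; ∙-congˡ; identityˡ; commutativeSemigroup; monoid)
  private module M = CommutativeMonoid M
  open import Algebra.Properties.CommutativeSemigroup commutativeSemigroup using (x∙yz≈y∙xz)
  open import Algebra.Properties.Monoid.Mult monoid using (×-homo-+) renaming (_×_ to _·_)

  erase : ∀ {n} → Fin n → (Fin n → Carrier) → Fin n → Carrier
  erase a f u = if does (u ≟ a) then ε else f u

  foldFin-cong : ∀ {n} {f g : Fin n → Carrier} → (∀ i → f i ≈ g i) →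
                 foldFin _∙_ ε f ≈ foldFin _∙_ ε g
  foldFin-cong {zero}  f≈g = M.refl
  foldFin-cong {suc n} f≈g = ∙-cong (f≈g zero) (foldFin-cong (f≈g ∘ suc))

  foldFin-ε : ∀ {n} → foldFin _∙_ ε {n} (λ _ → ε) ≈ ε
  foldFin-ε {zero}  = M.refl
  foldFin-ε {suc n} = M.trans (identityˡ _) (foldFin-ε {n})

  foldFin-erase : ∀ {n} (f : Fin n → Carrier) a → foldFin _∙_ ε f ≈ f a ∙ foldFin _∙_ ε (erase a f)
  foldFin-erase f zero    = ∙-congˡ (M.sym (identityˡ _))
  foldFin-erase f (suc a) = M.trans (∙-congˡ (foldFin-erase (f ∘ suc) a)) (x∙yz≈y∙xz _ _ _)

  foldFin-· : ∀ {n} (m : Fin n → ℕ) x → foldFin _∙_ ε (λ u → m u · x) ≈ foldFin _+_ 0 m · x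
  foldFin-· {zero}  m x = M.refl
  foldFin-· {suc n} m x = M.trans (∙-congˡ (foldFin-· (m ∘ suc) x)) (M.sym (×-homo-+ x (m zero) _))

module ℕΣ = FoldFin +-0-commutativeMonoid

module ℕΠ = FoldFin *-1-commutativeMonoid

foldFin-*-suc≢0 : ∀ {n} (f : Fin n → ℕ) → NonZero (foldFin _*_ 1 (λ i → suc (f i)))
foldFin-*-suc≢0 {zero}  f = _
foldFin-*-suc≢0 {suc n} f = m*n≢0 (suc (f zero)) _ {{_}} {{foldFin-*-suc≢0 (f ∘ suc)}}

module Degree {n : ℕ} (G : Graph n) where

  degExcept : Fin n → Fin n → ℕ
  degExcept v a = foldFin _+_ 0 (ℕΣ.erase a (λ u → if adj G v u then 1 else 0))

  deg≡suc-degExcept : ∀ {v a} → Adj G v a → deg G v ≡ suc (degExcept v a)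
  deg≡suc-degExcept {v} {a} va =
    trans (ℕΣ.foldFin-erase _ a) (cong (λ b → (if b then 1 else 0) + degExcept v a) va)

  2≤deg : ∀ {v a b} → Adj G v a → Adj G v b → a ≢ b → 2 ≤ deg G v
  2≤deg {v} {a} {b} va vb a≢b
    rewrite deg≡suc-degExcept va | ℕΣ.foldFin-erase (ℕΣ.erase a (λ u → if adj G v u then 1 else 0)) b
          | dec-false (b ≟ a) (≢-sym a≢b) | vb = s≤s (s≤s z≤n)

  deg≡1 : ∀ {v a} → Adj G v a → (∀ u → Adj G v u → u ≡ a) → deg G v ≡ 1
  deg≡1 {v} {a} va only =
    trans (deg≡suc-degExcept va) (cong suc (trans (ℕΣ.foldFin-cong others) (ℕΣ.foldFin-ε {n})))
    where
    others : ∀ u → ℕΣ.erase a (λ u → if adj G v u then 1 else 0) u ≡ 0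
    others u with u ≟ a
    ... | yes _ = refl
    ... | no u≢a with adj G v u in vu
    ...   | true  = ⊥-elim (u≢a (only u vu))
    ...   | false = refl

module Walks {n : ℕ} (G : Graph n) where

  Adj-sym : ∀ {u w} → Adj G u w → Adj G w u
  Adj-sym {u} {w} uw = trans (symm G w u) uw

  Adj⇒≢ : ∀ {u w} → Adj G u w → u ≢ w
  Adj⇒≢ {u} uw refl with () ← trans (sym (irrefl G u)) uw

  vertex : ∀ {u v k} → Walk G u v k → Fin (suc k) → Fin n
  vertex {u} _ zero          = u
  vertex (step _ W) (suc i)  = vertex W i

  IsPath : ∀ {u v k} → Walk G u v k → Set
  IsPath W = Injective _≡_ _≡_ (vertex W)

  vertex-last : ∀ {u v k} (W : Walk G u v k) → vertex W (fromℕ k) ≡ v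
  vertex-last here       = refl
  vertex-last (step _ W) = vertex-last W

  vertex-linked : ∀ {u v k} (W : Walk G u v (suc k)) (i : Fin (suc k)) →
                  Adj G (vertex W (inject₁ i)) (vertex W (suc i))
  vertex-linked (step e _)          zero    = e
  vertex-linked (step _ W@(step _ _)) (suc i) = vertex-linked W i

  prefix : ∀ {u v k} (W : Walk G u v k) (i : Fin (suc k)) → Walk G u (vertex W i) (toℕ i)
  prefix _          zero    = here
  prefix (step e W) (suc i) = step e (prefix W i)

  vertex-prefix : ∀ {u v k} (W : Walk G u v k) (i : Fin (suc k)) j .(p : suc (toℕ i) ≤ suc k) →
                  vertex (prefix W i) j ≡ vertex W (inject≤ j p)
  vertex-prefix _          zero    zero    _ = refl
  vertex-prefix (step _ W) (suc i) zero    _ = refl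
  vertex-prefix (step _ W) (suc i) (suc j) p = vertex-prefix W i j _

  prefix-isPath : ∀ {u v k} (W : Walk G u v k) i → IsPath W → IsPath (prefix W i)
  prefix-isPath W i path {x} {y} eq =
    inject≤-injective p p x y (path (trans (sym (vertex-prefix W i x p)) (trans eq (vertex-prefix W i y p))))
    where p = toℕ<n i

  isPath-tail : ∀ {u w v k} {e : Adj G u w} (W : Walk G w v k) → IsPath (step e W) → IsPath W
  isPath-tail W path eq = suc-injective (path eq)

  path⇒cycle : ∀ {u v m} (W : Walk G u v (suc (suc m))) → IsPath W → Adj G v u → Cycle G
  path⇒cycle {u} {m = m} W path vu = record
    { m = m ; vtx = vertex W ; distinct = λ _ _ → path ; linked = vertex-linked W
    ; closing = subst (λ x → Adj G x u) (sym (vertex-last W)) vu }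

  NonBacktracking : ∀ {u v k} → Walk G u v k → Set
  NonBacktracking here                            = ⊤
  NonBacktracking (step _ here)                   = ⊤
  NonBacktracking (step {u} _ (step {w = x} e W)) = u ≢ x × NonBacktracking (step e W)

  edge-isPath : ∀ {u w} (e : Adj G u w) → IsPath (step e here)
  edge-isPath e {zero}     {zero}     _  = refl
  edge-isPath e {zero}     {suc zero} eq = ⊥-elim (Adj⇒≢ e eq)
  edge-isPath e {suc zero} {zero}     eq = ⊥-elim (Adj⇒≢ e (sym eq))
  edge-isPath e {suc zero} {suc zero} _  = refl

  module _ (acyclic : Acyclic G) where

    step-isPath : ∀ {w u p v k} (e : Adj G w u) (e′ : Adj G u p) (P : Walk G p v k) →
                  IsPath (step e′ P) → w ≢ p → IsPath (step e (step e′ P))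
    step-isPath {w} {u} e e′ P path w≢p = injective
      where
      avoids : ∀ j → vertex (step e′ P) j ≢ w
      avoids zero          = ≢-sym (Adj⇒≢ e)
      avoids (suc zero)    = ≢-sym w≢p
      avoids (suc (suc j)) eq =
        acyclic (path⇒cycle (prefix (step e′ P) (suc (suc j))) (prefix-isPath _ (suc (suc j)) path)
                            (subst (λ x → Adj G x u) (sym eq) e))

      injective : IsPath (step e (step e′ P))
      injective {zero}  {zero}  _  = refl
      injective {zero}  {suc j} eq = ⊥-elim (avoids j (sym eq))
      injective {suc i} {zero}  eq = ⊥-elim (avoids i eq)
      injective {suc i} {suc j} eq = cong suc (path eq)

    nonBacktracking⇒isPath : ∀ {u v k} (W : Walk G u v k) → NonBacktracking W → IsPath W
    nonBacktracking⇒isPath here                 _          {zero} {zero} _ = refl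
    nonBacktracking⇒isPath (step e here)        _          = edge-isPath e
    nonBacktracking⇒isPath (step e (step e′ W)) (u≢x , nb) =
      step-isPath e e′ W (nonBacktracking⇒isPath (step e′ W) nb) u≢x

    isPath⇒shortest : ∀ {u v j k} (P : Walk G u v k) → IsPath P → Walk G u v j → k ≤ j
    isPath⇒shortest here          _    _ = z≤n
    isPath⇒shortest P@(step _ _)  path here with () ← path {zero} {fromℕ _} (sym (vertex-last P))
    isPath⇒shortest (step {w = p} e′ P) path (step {w = w} e W) with w ≟ p
    ... | yes refl = s≤s (isPath⇒shortest P (isPath-tail P path) W)
    -- W leaves u towards w ≠ p; prepending the edge w u to P gives a path no longer than the rest of W
    ... | no w≢p   = m≤n⇒m≤1+n (≤-trans (n≤1+n _)
                       (isPath⇒shortest (step (Adj-sym e) (step e′ P)) (step-isPath (Adj-sym e) e′ P path w≢p) W))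

  walk? : ∀ u v k → Dec (Walk G u v k)
  walk? u v zero with u ≟ v
  ... | yes refl = yes here
  ... | no u≢v   = no λ { here → u≢v refl }
  walk? u v (suc k) =
    map′ (λ (_ , e , W) → step e W) (λ { (step e W) → _ , e , W })
         (any? (λ w → (adj G u w Bool.≟ true) ×-dec walk? w v k))

  dist : Connected G → ∀ u v → ∃ (Dist G u v)
  dist connected u v = least (walk? u v) (proj₂ (connected u v))

  shortest⇒nonBacktracking : ∀ {u v k} (W : Walk G u v k) → (∀ j → Walk G u v j → k ≤ j) →
                             NonBacktracking W
  shortest⇒nonBacktracking here                 _        = tt
  shortest⇒nonBacktracking (step _ here)        _        = tt
  shortest⇒nonBacktracking (step e (step e′ W)) shortest =
      (λ { refl → 1+n≰n (≤-trans (n≤1+n _) (shortest _ W)) })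
    , shortest⇒nonBacktracking (step e′ W) (λ j W′ → ≤-pred (shortest (suc j) (step e W′)))

module TreeOfDiameter {n : ℕ} {T : Graph n} (tree : IsTree T) {d : ℕ} (diameter : HasDiameter T d) where
  open Walks T

  nonBacktracking-≤ : ∀ {u v k} (P : Walk T u v k) → NonBacktracking P → k ≤ d
  nonBacktracking-≤ {u} {v} P nb =
    let (j , W , shortest) = dist (proj₁ tree) u v
    in ≤-trans (isPath⇒shortest (proj₂ tree) P (nonBacktracking⇒isPath (proj₂ tree) P nb) W)
               (proj₂ diameter u v j (W , shortest))

  nonBacktracking-walk : ∀ u v → ∃ λ k → Σ (Walk T u v k) NonBacktracking
  nonBacktracking-walk u v =
    let (k , W , shortest) = dist (proj₁ tree) u v in k , W , shortest⇒nonBacktracking W shortest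

record Spine {n : ℕ} (T : Graph n) (c₁ c₂ : Fin n) : Set where
  field
    x₀ x₁ x₄ x₅ : Fin n
    x₀x₁ : Adj T x₀ x₁
    x₁c₁ : Adj T x₁ c₁
    c₁c₂ : Adj T c₁ c₂
    c₂x₄ : Adj T c₂ x₄
    x₄x₅ : Adj T x₄ x₅
    x₀≢c₁ : x₀ ≢ c₁
    x₁≢c₂ : x₁ ≢ c₂
    c₁≢x₄ : c₁ ≢ x₄
    c₂≢x₅ : c₂ ≢ x₅

module _ {n : ℕ} {T : Graph n} where
  open Walks T

  reverse : ∀ {c₁ c₂} → Spine T c₁ c₂ → Spine T c₂ c₁
  reverse S = record
    { x₀ = x₅ ; x₁ = x₄ ; x₄ = x₁ ; x₅ = x₀
    ; x₀x₁ = Adj-sym x₄x₅ ; x₁c₁ = Adj-sym c₂x₄ ; c₁c₂ = Adj-sym c₁c₂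
    ; c₂x₄ = Adj-sym x₁c₁ ; x₄x₅ = Adj-sym x₀x₁
    ; x₀≢c₁ = ≢-sym c₂≢x₅ ; x₁≢c₂ = ≢-sym c₁≢x₄
    ; c₁≢x₄ = ≢-sym x₁≢c₂ ; c₂≢x₅ = ≢-sym x₀≢c₁ }
    where open Spine S

  centralPair⇒spine : ∀ {c₁ c₂} → CentralPair T c₁ c₂ → Spine T c₁ c₂
  centralPair⇒spine (x₀ , x₁ , x₄ , x₅ , x₀x₁ , x₁c₁ , c₁c₂ , c₂x₄ , x₄x₅ , _ , shortest) =
    record
    { x₀x₁ = x₀x₁ ; x₁c₁ = x₁c₁ ; c₁c₂ = c₁c₂ ; c₂x₄ = c₂x₄ ; x₄x₅ = x₄x₅
    ; x₀≢c₁ = λ { refl → no-shortcut (step c₁c₂ (step c₂x₄ (step x₄x₅ here))) }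
    ; x₁≢c₂ = λ { refl → no-shortcut (step x₀x₁ (step c₂x₄ (step x₄x₅ here))) }
    ; c₁≢x₄ = λ { refl → no-shortcut (step x₀x₁ (step x₁c₁ (step x₄x₅ here))) }
    ; c₂≢x₅ = λ { refl → no-shortcut (step x₀x₁ (step x₁c₁ (step c₁c₂ here))) } }
    where
    no-shortcut : Walk T x₀ x₅ 3 → ⊥
    no-shortcut W with s≤s (s≤s (s≤s ())) ← shortest 3 W

module _ {n : ℕ} (T : Graph n) where

  Inner : Fin n → Fin n → Fin n → Set
  Inner c₁ c₂ a = Adj T c₁ a × a ≢ c₂

  data Near (c₁ c₂ v : Fin n) : Set where
    centre : v ≡ c₁ → Near c₁ c₂ v
    inner  : Inner c₁ c₂ v → Near c₁ c₂ v
    outer  : ∀ {a} → Inner c₁ c₂ a → Adj T a v → v ≢ c₁ → Near c₁ c₂ v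

module Centre {n : ℕ} {T : Graph n}
    (nb≤5 : ∀ {u v k} (P : Walk T u v k) → Walks.NonBacktracking T P → k ≤ 5)
    {c₁ c₂ : Fin n} (S : Spine T c₁ c₂) where
  open Walks T
  open Degree T
  open Spine S

  too-long : ∀ {k} → ¬ 6 + k ≤ 5
  too-long (s≤s (s≤s (s≤s (s≤s (s≤s ())))))

  -- going twice around a triangle c₁ c₂ b is a non-backtracking walk of length 6
  no-common-neighbour : ∀ {b} → Adj T c₁ b → ¬ Adj T c₂ b
  no-common-neighbour {b} c₁b c₂b =
    too-long (nb≤5 (step c₁c₂ (step c₂b (step bc₁ (step c₁c₂ (step c₂b (step bc₁ here))))))
                   (c₁≢b , c₂≢c₁ , b≢c₂ , c₁≢b , c₂≢c₁ , tt))
    where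
    bc₁ : Adj T b c₁
    bc₁ = Adj-sym c₁b
    c₁≢b : c₁ ≢ b
    c₁≢b = Adj⇒≢ c₁b
    c₂≢c₁ : c₂ ≢ c₁
    c₂≢c₁ = ≢-sym (Adj⇒≢ c₁c₂)
    b≢c₂ : b ≢ c₂
    b≢c₂ = ≢-sym (Adj⇒≢ c₂b)

  outer-only-neighbour : ∀ {a u w} → Inner T c₁ c₂ a → Adj T a u → u ≢ c₁ → Adj T u w → w ≡ a
  outer-only-neighbour {a} {u} {w} (c₁a , a≢c₂) au u≢c₁ uw with w ≟ a
  ... | yes w≡a = w≡a
  ... | no w≢a  = ⊥-elim (too-long (nb≤5 walk (w≢a , u≢c₁ , a≢c₂ , c₁≢x₄ , c₂≢x₅ , tt)))
    where
    walk : Walk T w x₅ 6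
    walk = step (Adj-sym uw) (step (Adj-sym au) (step (Adj-sym c₁a) (step c₁c₂ (step c₂x₄ (step x₄x₅ here)))))

  outer≢c₂ : ∀ {a u} → Inner T c₁ c₂ a → Adj T a u → u ≢ c₂
  outer≢c₂ (c₁a , _) au refl = no-common-neighbour c₁a (Adj-sym au)

  outer-¬c₁-adjacent : ∀ {a u} → Inner T c₁ c₂ a → Adj T a u → u ≢ c₁ → ¬ Adj T c₁ u
  outer-¬c₁-adjacent A@(c₁a , _) au u≢c₁ c₁u = Adj⇒≢ c₁a (outer-only-neighbour A au u≢c₁ (Adj-sym c₁u))

  outer-¬c₂-adjacent : ∀ {a u} → Inner T c₁ c₂ a → Adj T a u → u ≢ c₁ → ¬ Adj T c₂ u
  outer-¬c₂-adjacent A@(_ , a≢c₂) au u≢c₁ c₂u = a≢c₂ (sym (outer-only-neighbour A au u≢c₁ (Adj-sym c₂u)))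

  inner-has-outer : ¬ IsSupport T c₁ → ∀ {a} → Inner T c₁ c₂ a → ∃ λ u → Adj T a u × u ≢ c₁
  inner-has-outer nonSupport {a} (c₁a , _) with any? (λ u → (adj T a u Bool.≟ true) ×-dec ¬? (u ≟ c₁))
  ... | yes found = found
  ... | no none   = ⊥-elim (nonSupport (a , c₁a , deg≡1 (Adj-sym c₁a) only-c₁))
    where
    only-c₁ : ∀ u → Adj T a u → u ≡ c₁
    only-c₁ u au with u ≟ c₁
    ... | yes u≡c₁ = u≡c₁
    ... | no u≢c₁  = ⊥-elim (none (u , au , u≢c₁))

  inner-2≤deg : ¬ IsSupport T c₁ → ∀ {a} → Inner T c₁ c₂ a → 2 ≤ deg T a
  inner-2≤deg nonSupport A@(c₁a , _) =
    let (u , au , u≢c₁) = inner-has-outer nonSupport A in 2≤deg (Adj-sym c₁a) au (≢-sym u≢c₁)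

  2≤deg-c₁ : 2 ≤ deg T c₁
  2≤deg-c₁ = 2≤deg c₁c₂ (Adj-sym x₁c₁) (≢-sym x₁≢c₂)

  module _ (reach : ∀ u v → ∃ λ k → Σ (Walk T u v k) NonBacktracking) where

    private
      away-from-c₂ : ∀ {p v k} (c₁p : Adj T c₁ p) (P : Walk T p v k) →
                     NonBacktracking (step c₁p P) → p ≢ c₂ → 4 + k ≤ 5
      away-from-c₂ c₁p P nb p≢c₂ =
        nb≤5 (step (Adj-sym x₄x₅) (step (Adj-sym c₂x₄) (step (Adj-sym c₁c₂) (step c₁p P))))
             (≢-sym c₂≢x₅ , ≢-sym c₁≢x₄ , ≢-sym p≢c₂ , nb)

      near : ∀ {v k} (P : Walk T c₁ v k) → NonBacktracking P → Near T c₁ c₂ v ⊎ Near T c₂ c₁ v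
      near here _ = inj₁ (centre refl)
      near {v} (step c₁v here) _ with v ≟ c₂
      ... | yes v≡c₂ = inj₂ (centre v≡c₂)
      ... | no v≢c₂  = inj₁ (inner (c₁v , v≢c₂))
      near {v} (step {w = p} c₁p (step pv here)) (c₁≢v , _) with p ≟ c₂
      ... | yes refl = inj₂ (inner (pv , ≢-sym c₁≢v))
      ... | no p≢c₂  = inj₁ (outer (c₁p , p≢c₂) pv (≢-sym c₁≢v))
      near {v} (step {w = p} c₁p P@(step pq (step qv here))) nb@(c₁≢q , p≢v , _) with p ≟ c₂
      ... | yes refl = inj₂ (outer (pq , ≢-sym c₁≢q) qv (≢-sym p≢v))
      ... | no p≢c₂  = ⊥-elim (too-long (away-from-c₂ c₁p P nb p≢c₂))
      near (step {w = p} c₁p P@(step _ (step _ (step _ _)))) nb with p ≟ c₂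
      ... | yes refl = ⊥-elim (too-long (nb≤5 (step x₀x₁ (step x₁c₁ (step c₁p P))) (x₀≢c₁ , x₁≢c₂ , nb)))
      ... | no p≢c₂  = ⊥-elim (too-long (away-from-c₂ c₁p P nb p≢c₂))

    classify : ∀ v → Near T c₁ c₂ v ⊎ Near T c₂ c₁ v
    classify v = let (_ , P , nb) = reach c₁ v in near P nb

module Weights {c ℓ : Level} (Γ : AbelianGroup c ℓ) where
  open AbelianGroup Γ
    using (Carrier; _≈_; _≉_; _∙_; ε; _⁻¹; ∙-congˡ; ∙-congʳ; identityʳ; comm; setoid; commutativeMonoid)
  private module Γ = AbelianGroup Γ
  open import Algebra.Properties.AbelianGroup Γ using (\\-leftDividesʳ; ⁻¹-injective; ε⁻¹≈ε)
  open import Algebra.Properties.CommutativeMonoid.Mult commutativeMonoid public using () renaming (_×_ to _·_)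
  open import Algebra.Properties.CommutativeMonoid.Mult commutativeMonoid using (×-homo-1)
  open import Relation.Binary.Reasoning.Setoid setoid
  private module ΓΣ = FoldFin commutativeMonoid

  ·-agrees : ∀ k x → Defs._·_ Γ k x ≈ k · x
  ·-agrees zero    x = Γ.refl
  ·-agrees (suc k) x = ∙-congˡ (·-agrees k x)

  weight-split : ∀ {n} (G : Graph n) (lab : Fin n → Carrier) {v a} x → Adj G v a →
                 (∀ u → Adj G v u → u ≢ a → lab u ≈ x) → weight Γ G lab v ≈ lab a ∙ (deg G v ∸ 1) · x
  weight-split G lab {v} {a} x va others = begin
    weight Γ G lab v
      ≈⟨ ΓΣ.foldFin-erase (λ u → if adj G v u then lab u else ε) a ⟩
    (if adj G v a then lab a else ε) ∙ foldFin _∙_ ε (ΓΣ.erase a (λ u → if adj G v u then lab u else ε))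
      ≈⟨ ∙-congʳ (Γ.reflexive (cong (λ b → if b then lab a else ε) va)) ⟩
    lab a ∙ foldFin _∙_ ε (ΓΣ.erase a (λ u → if adj G v u then lab u else ε))
      ≈⟨ ∙-congˡ (ΓΣ.foldFin-cong termwise) ⟩
    lab a ∙ foldFin _∙_ ε (λ u → ℕΣ.erase a (λ u → if adj G v u then 1 else 0) u · x)
      ≈⟨ ∙-congˡ (ΓΣ.foldFin-· (ℕΣ.erase a (λ u → if adj G v u then 1 else 0)) x) ⟩
    lab a ∙ Degree.degExcept G v a · x
      ≡⟨ cong (λ d → lab a ∙ (d ∸ 1) · x) (sym (Degree.deg≡suc-degExcept G va)) ⟩
    lab a ∙ (deg G v ∸ 1) · x ∎
    where
    termwise : ∀ u → ΓΣ.erase a (λ u → if adj G v u then lab u else ε) u ≈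
                     ℕΣ.erase a (λ u → if adj G v u then 1 else 0) u · x
    termwise u with u ≟ a
    ... | yes _ = Γ.refl
    ... | no u≢a with adj G v u in vu
    ...   | true  = Γ.trans (others u vu u≢a) (Γ.sym (×-homo-1 x))
    ...   | false = Γ.refl

  weight-pendant : ∀ {n} (G : Graph n) (lab : Fin n → Carrier) {v a} → Adj G v a →
                   (∀ u → Adj G v u → u ≡ a) → weight Γ G lab v ≈ lab a
  weight-pendant G lab {v} {a} va only = begin
    weight Γ G lab v              ≈⟨ weight-split G lab ε va (λ u vu u≢a → ⊥-elim (u≢a (only u vu))) ⟩
    lab a ∙ (deg G v ∸ 1) · ε     ≡⟨ cong (λ d → lab a ∙ (d ∸ 1) · ε) (Degree.deg≡1 G va only) ⟩
    lab a ∙ ε                     ≈⟨ identityʳ (lab a) ⟩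
    lab a                         ∎

  centreValue : ℕ → Carrier → Carrier
  centreValue d μ = ((d ∸ 2) · μ) ⁻¹

  centreValue-balance : ∀ {d} μ → 2 ≤ d → centreValue d μ ∙ (d ∸ 1) · μ ≈ μ
  centreValue-balance {suc (suc k)} μ _ = begin
    (k · μ) ⁻¹ ∙ (μ ∙ k · μ)   ≈⟨ ∙-congˡ (comm μ (k · μ)) ⟩
    (k · μ) ⁻¹ ∙ (k · μ ∙ μ)   ≈⟨ \\-leftDividesʳ (k · μ) μ ⟩
    μ                          ∎
  centreValue-balance {suc zero} μ (s≤s ())

  ⁻¹-≉ε : ∀ {x} → x ≉ ε → x ⁻¹ ≉ ε
  ⁻¹-≉ε x≉ε x⁻¹≈ε = x≉ε (⁻¹-injective (Γ.trans x⁻¹≈ε (Γ.sym ε⁻¹≈ε)))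

module Necessity {c ℓ : Level} (Γ : AbelianGroup c ℓ) {n : ℕ} {T : Graph n}
    (nb≤5 : ∀ {u v k} (P : Walk T u v k) → Walks.NonBacktracking T P → k ≤ 5)
    {c₁ c₂ : Fin n} (S : Spine T c₁ c₂) (nonSupport : ¬ IsSupport T c₁)
    (lab : Fin n → AbelianGroup.Carrier Γ) (μ : AbelianGroup.Carrier Γ)
    (balanced : ∀ v → AbelianGroup._≈_ Γ (weight Γ T lab v) μ) where
  open AbelianGroup Γ using (_≈_; _≉_; _∙_; ε; ∙-congˡ; identityʳ; setoid)
  private module Γ = AbelianGroup Γ
  open import Algebra.Properties.AbelianGroup Γ using (identityˡ-unique)
  open import Relation.Binary.Reasoning.Setoid setoid
  open Weights Γ
  open Walks T using (Adj-sym)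
  open Centre nb≤5 S
  open Spine S using (c₁c₂)

  inner-label≈μ : ∀ {a} → Inner T c₁ c₂ a → lab a ≈ μ
  inner-label≈μ A =
    let (u , au , u≢c₁) = inner-has-outer nonSupport A
    in Γ.trans (Γ.sym (weight-pendant T lab (Adj-sym au) (λ _ → outer-only-neighbour A au u≢c₁))) (balanced u)

  deg-c₁≢2 : lab c₂ ≉ ε → deg T c₁ ≢ 2
  deg-c₁≢2 c₂≉ε deg≡2 = c₂≉ε (identityˡ-unique (lab c₂) μ (begin
    lab c₂ ∙ μ                     ≈⟨ ∙-congˡ (identityʳ μ) ⟨
    lab c₂ ∙ (2 ∸ 1) · μ           ≡⟨ cong (λ d → lab c₂ ∙ (d ∸ 1) · μ) deg≡2 ⟨
    lab c₂ ∙ (deg T c₁ ∸ 1) · μ    ≈⟨ weight-split T lab μ c₁c₂ (λ _ c₁u u≢c₂ → inner-label≈μ (c₁u , u≢c₂)) ⟨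
    weight Γ T lab c₁              ≈⟨ balanced c₁ ⟩
    μ                              ∎))

module Sufficiency {c ℓ : Level} (Γ : AbelianGroup c ℓ) (g : AbelianGroup.Carrier Γ)
    (g-infinite : HasInfiniteOrder Γ g) {n : ℕ} (T : Graph n) where
  open AbelianGroup Γ using (Carrier; _≈_; _≉_; _∙_; ε; ∙-cong; setoid; commutativeMonoid)
  private module Γ = AbelianGroup Γ
  open import Algebra.Properties.CommutativeMonoid.Mult commutativeMonoid using (×-assocˡ)
  open import Relation.Binary.Reasoning.Setoid setoid
  open Weights Γ
  open Walks T

  ·g≉ε : ∀ k → .{{NonZero k}} → k · g ≉ ε
  ·g≉ε (suc k) k·g≈ε = g-infinite k (Γ.trans (·-agrees (suc k) g) k·g≈ε)

  fanout : Fin n → ℕ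
  fanout s = suc (deg T s ∸ 2)

  fanout≡deg∸1 : ∀ {s} → 2 ≤ deg T s → fanout s ≡ deg T s ∸ 1
  fanout≡deg∸1 = suc[m∸2]≡m∸1
    where
    suc[m∸2]≡m∸1 : ∀ {m} → 2 ≤ m → suc (m ∸ 2) ≡ m ∸ 1
    suc[m∸2]≡m∸1 {suc (suc m)} _          = refl
    suc[m∸2]≡m∸1 {suc zero}    (s≤s ())

  M : ℕ
  M = foldFin _*_ 1 fanout

  fanout∣M : ∀ s → fanout s ∣ M
  fanout∣M s = divides (foldFin _*_ 1 (ℕΠ.erase s fanout))
                       (trans (ℕΠ.foldFin-erase fanout s) (*-comm (fanout s) _))

  instance
    M≢0 : NonZero M
    M≢0 = foldFin-*-suc≢0 (λ s → deg T s ∸ 2)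

  μ : Carrier
  μ = M · g

  leafValue : ℕ → Fin n → Carrier
  leafValue d s = ((d ∸ 1) * quotient (fanout∣M s)) · g

  ≈-≉ε : ∀ {x y} → x ≈ y → y ≉ ε → x ≉ ε
  ≈-≉ε x≈y y≉ε x≈ε = y≉ε (Γ.trans (Γ.sym x≈y) x≈ε)

  μ≉ε : μ ≉ ε
  μ≉ε = ·g≉ε M

  centreValue≉ε : ∀ {d} → 2 < d → centreValue d μ ≉ ε
  centreValue≉ε {suc (suc (suc k))} _ =
    ⁻¹-≉ε (λ h → ·g≉ε (suc k * M) {{m*n≢0 (suc k) M}} (Γ.trans (Γ.sym (×-assocˡ g (suc k) M)) h))
  centreValue≉ε {suc zero}       (s≤s ())
  centreValue≉ε {suc (suc zero)} (s≤s (s≤s ()))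

  leafValue≉ε : ∀ {d} s → 2 ≤ d → leafValue d s ≉ ε
  leafValue≉ε {suc (suc k)} s _ =
    ·g≉ε (suc k * quotient (fanout∣M s)) {{m*n≢0 (suc k) _ {{_}} {{quotient≢0 (fanout∣M s)}}}}
  leafValue≉ε {suc zero} s (s≤s ())

  leaves-balance : ∀ {a} d → 2 ≤ deg T a → (deg T a ∸ 1) · leafValue d a ≈ (d ∸ 1) · μ
  leaves-balance {a} d 2≤deg = begin
    (deg T a ∸ 1) · ((d ∸ 1) * q) · g    ≈⟨ ×-assocˡ g (deg T a ∸ 1) ((d ∸ 1) * q) ⟩
    ((deg T a ∸ 1) * ((d ∸ 1) * q)) · g  ≡⟨ cong (_· g) arithmetic ⟩
    ((d ∸ 1) * M) · g                    ≈⟨ ×-assocˡ g (d ∸ 1) M ⟨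
    (d ∸ 1) · μ                          ∎
    where
    q : ℕ
    q = quotient (fanout∣M a)
    arithmetic : (deg T a ∸ 1) * ((d ∸ 1) * q) ≡ (d ∸ 1) * M
    arithmetic = trans (cong (_* ((d ∸ 1) * q)) (sym (fanout≡deg∸1 2≤deg)))
                   (trans (*-comm (fanout a) _)
                     (trans (*-assoc (d ∸ 1) q (fanout a))
                       (cong ((d ∸ 1) *_) (sym (_∣_.equality (fanout∣M a))))))

  module Balance (nb≤5 : ∀ {u v k} (P : Walk T u v k) → NonBacktracking P → k ≤ 5)
      {c₁ c₂ : Fin n} (S : Spine T c₁ c₂) (nonSupport : ¬ IsSupport T c₁) (lab : Fin n → Carrier)
      (lab-c₁ : lab c₁ ≈ centreValue (deg T c₂) μ)
      (lab-c₂ : lab c₂ ≈ centreValue (deg T c₁) μ)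
      (lab-inner : ∀ {a} → Inner T c₁ c₂ a → lab a ≈ μ)
      (lab-outer : ∀ {a u} → Inner T c₁ c₂ a → Adj T a u → u ≢ c₁ → lab u ≈ leafValue (deg T c₂) a)
    where
    open Centre nb≤5 S
    open Spine S using (c₁c₂)

    2≤deg-c₂ : 2 ≤ deg T c₂
    2≤deg-c₂ = Centre.2≤deg-c₁ nb≤5 (reverse S)

    weight-near : ∀ {v} → Near T c₁ c₂ v → weight Γ T lab v ≈ μ
    weight-near (centre refl) = begin
      weight Γ T lab c₁
        ≈⟨ weight-split T lab μ c₁c₂ (λ u c₁u u≢c₂ → lab-inner (c₁u , u≢c₂)) ⟩
      lab c₂ ∙ (deg T c₁ ∸ 1) · μ
        ≈⟨ ∙-cong lab-c₂ Γ.refl ⟩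
      centreValue (deg T c₁) μ ∙ (deg T c₁ ∸ 1) · μ
        ≈⟨ centreValue-balance μ 2≤deg-c₁ ⟩
      μ ∎
    weight-near {a} (inner A@(c₁a , _)) = begin
      weight Γ T lab a
        ≈⟨ weight-split T lab (leafValue (deg T c₂) a) (Adj-sym c₁a) (λ _ au u≢c₁ → lab-outer A au u≢c₁) ⟩
      lab c₁ ∙ (deg T a ∸ 1) · leafValue (deg T c₂) a
        ≈⟨ ∙-cong lab-c₁ (leaves-balance (deg T c₂) (inner-2≤deg nonSupport A)) ⟩
      centreValue (deg T c₂) μ ∙ (deg T c₂ ∸ 1) · μ
        ≈⟨ centreValue-balance μ 2≤deg-c₂ ⟩
      μ ∎
    weight-near {u} (outer {a} A au u≢c₁) = begin
      weight Γ T lab u  ≈⟨ weight-pendant T lab (Adj-sym au) (λ _ → outer-only-neighbour A au u≢c₁) ⟩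
      lab a             ≈⟨ lab-inner A ⟩
      μ                 ∎

    label-near-≉ε : deg T c₂ ≢ 2 → ∀ {v} → Near T c₁ c₂ v → lab v ≉ ε
    label-near-≉ε deg≢2 (centre refl)         =
      ≈-≉ε lab-c₁ (centreValue≉ε (≤∧≢⇒< 2≤deg-c₂ (≢-sym deg≢2)))
    label-near-≉ε deg≢2 (inner A)             = ≈-≉ε (lab-inner A) μ≉ε
    label-near-≉ε deg≢2 (outer {a} A au u≢c₁) = ≈-≉ε (lab-outer A au u≢c₁) (leafValue≉ε a 2≤deg-c₂)

  module Labelling (c₁ c₂ : Fin n) where

    pendantValue : Fin n → Carrier
    pendantValue s = if adj T c₁ s then leafValue (deg T c₂) s else leafValue (deg T c₁) s

    -- the label of a pendant vertex is read off its unique neighbour as a weight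
    label : Fin n → Carrier
    label v = if does (v ≟ c₁) then centreValue (deg T c₂) μ
              else if does (v ≟ c₂) then centreValue (deg T c₁) μ
              else if adj T c₁ v ∨ adj T c₂ v then μ
              else weight Γ T pendantValue v

    label-c₁ : label c₁ ≡ centreValue (deg T c₂) μ
    label-c₁ rewrite dec-true (c₁ ≟ c₁) refl = refl

    label-c₂ : c₂ ≢ c₁ → label c₂ ≡ centreValue (deg T c₁) μ
    label-c₂ c₂≢c₁ rewrite dec-false (c₂ ≟ c₁) c₂≢c₁ | dec-true (c₂ ≟ c₂) refl = refl

    label-adjacent : ∀ {v} → v ≢ c₁ → v ≢ c₂ → Adj T c₁ v ⊎ Adj T c₂ v → label v ≡ μ
    label-adjacent {v} v≢c₁ v≢c₂ adjacent rewrite dec-false (v ≟ c₁) v≢c₁ | dec-false (v ≟ c₂) v≢c₂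
      with adjacent
    ... | inj₁ c₁v rewrite c₁v                         = refl
    ... | inj₂ c₂v rewrite c₂v | ∨-zeroʳ (adj T c₁ v) = refl

    label-pendant : ∀ {v} → v ≢ c₁ → v ≢ c₂ → ¬ Adj T c₁ v → ¬ Adj T c₂ v →
                    label v ≡ weight Γ T pendantValue v
    label-pendant {v} v≢c₁ v≢c₂ ¬c₁v ¬c₂v
      rewrite dec-false (v ≟ c₁) v≢c₁ | dec-false (v ≟ c₂) v≢c₂ | ¬-not ¬c₁v | ¬-not ¬c₂v = refl

    module _ (nb≤5 : ∀ {u v k} (P : Walk T u v k) → NonBacktracking P → k ≤ 5) (S : Spine T c₁ c₂) where
      private
        module C₁ = Centre nb≤5 S
        module C₂ = Centre nb≤5 (reverse S)

      c₂≢c₁ : c₂ ≢ c₁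
      c₂≢c₁ = ≢-sym (Adj⇒≢ (Spine.c₁c₂ S))

      label-outer₁ : ∀ {a u} → Inner T c₁ c₂ a → Adj T a u → u ≢ c₁ → label u ≈ leafValue (deg T c₂) a
      label-outer₁ {a} {u} A@(c₁a , _) au u≢c₁ = begin
        label u
          ≡⟨ label-pendant u≢c₁ (C₁.outer≢c₂ A au)
                           (C₁.outer-¬c₁-adjacent A au u≢c₁) (C₁.outer-¬c₂-adjacent A au u≢c₁) ⟩
        weight Γ T pendantValue u
          ≈⟨ weight-pendant T pendantValue (Adj-sym au) (λ _ → C₁.outer-only-neighbour A au u≢c₁) ⟩
        pendantValue a
          ≡⟨ cong (if_then leafValue (deg T c₂) a else leafValue (deg T c₁) a) c₁a ⟩
        leafValue (deg T c₂) a ∎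

      label-outer₂ : ∀ {b u} → Inner T c₂ c₁ b → Adj T b u → u ≢ c₂ → label u ≈ leafValue (deg T c₁) b
      label-outer₂ {b} {u} B@(c₂b , _) bu u≢c₂ = begin
        label u
          ≡⟨ label-pendant (C₂.outer≢c₂ B bu) u≢c₂
                           (C₂.outer-¬c₂-adjacent B bu u≢c₂) (C₂.outer-¬c₁-adjacent B bu u≢c₂) ⟩
        weight Γ T pendantValue u
          ≈⟨ weight-pendant T pendantValue (Adj-sym bu) (λ _ → C₂.outer-only-neighbour B bu u≢c₂) ⟩
        pendantValue b
          ≡⟨ cong (if_then leafValue (deg T c₂) b else leafValue (deg T c₁) b)
                  (¬-not (λ c₁b → C₁.no-common-neighbour c₁b c₂b)) ⟩
        leafValue (deg T c₁) b ∎

      magic : (∀ u v → ∃ λ k → Σ (Walk T u v k) NonBacktracking) →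
              ¬ IsSupport T c₁ → ¬ IsSupport T c₂ → deg T c₁ ≢ 2 → deg T c₂ ≢ 2 → IsVertexMagic Γ T
      magic reach ns₁ ns₂ deg₁≢2 deg₂≢2 = label , nonzero , μ , balanced
        where
        module B₁ = Balance nb≤5 S ns₁ label
                      (Γ.reflexive label-c₁) (Γ.reflexive (label-c₂ c₂≢c₁))
                      (λ (c₁a , a≢c₂) → Γ.reflexive (label-adjacent (≢-sym (Adj⇒≢ c₁a)) a≢c₂ (inj₁ c₁a)))
                      label-outer₁
        module B₂ = Balance nb≤5 (reverse S) ns₂ label
                      (Γ.reflexive (label-c₂ c₂≢c₁)) (Γ.reflexive label-c₁)
                      (λ (c₂b , b≢c₁) → Γ.reflexive (label-adjacent b≢c₁ (≢-sym (Adj⇒≢ c₂b)) (inj₂ c₂b)))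
                      label-outer₂

        nonzero : ∀ v → label v ≉ ε
        nonzero v = [ B₁.label-near-≉ε deg₂≢2 , B₂.label-near-≉ε deg₁≢2 ] (C₁.classify reach v)

        balanced : ∀ v → weight Γ T label v ≈ μ
        balanced v = [ B₁.weight-near , B₂.weight-near ] (C₁.classify reach v)

theorem4p4 : ∀ {c ℓ : Level} (Γ : AbelianGroup c ℓ) → IsInfiniteGroup Γ → IsNotTorsion Γ →
    ∀ {n : ℕ} (T : Graph n) → IsTree T → HasDiameter T 5 →
    ∀ (c1 c2 : Fin n) → CentralPair T c1 c2 →
    ¬ IsSupport T c1 → ¬ IsSupport T c2 →
    (IsVertexMagic Γ T ⇔ (deg T c1 ≢ 2 × deg T c2 ≢ 2))
theorem4p4 Γ _ (g , g-infinite) T tree diameter c1 c2 central ns₁ ns₂ = mk⇔ necessity sufficiency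
  where
  open TreeOfDiameter tree diameter

  S : Spine T c1 c2
  S = centralPair⇒spine central

  necessity : IsVertexMagic Γ T → deg T c1 ≢ 2 × deg T c2 ≢ 2
  necessity (lab , nonzero , μ , balanced) =
      Necessity.deg-c₁≢2 Γ nonBacktracking-≤ S ns₁ lab μ balanced (nonzero c2)
    , Necessity.deg-c₁≢2 Γ nonBacktracking-≤ (reverse S) ns₂ lab μ balanced (nonzero c1)

  sufficiency : deg T c1 ≢ 2 × deg T c2 ≢ 2 → IsVertexMagic Γ T
  sufficiency (deg₁≢2 , deg₂≢2) =
    Sufficiency.Labelling.magic Γ g g-infinite T c1 c2 nonBacktracking-≤ S
      nonBacktracking-walk ns₁ ns₂ deg₁≢2 deg₂≢2
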